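{- Assume the standing setting below. Then: (a) $|T^{(i)}|=n$ for every $i\in[-k_1-k_2,k_1+k_2]^{*}$; (b) if $-k_2\le i\le k_1+k_2$ and $j\in[-k_2,k_1]^{*}$, then for any $g,h\in T$, $g^i=h^j$ implies $g=h$; (c) for any $i\in[-k_1-k_2,0]$, the sets $T^{(i)},T^{(i+1)},\dots,T^{(i+k_1+k_2)}$ are pairwise disjoint; in particular $\psi(\ell,i)=0$ whenever $0<\ell-i\le k_1+k_2$; (d) for any $\ell\in[k_1+1,2k_1]$ and $-k_1-k_2\le i\le 0$, $\sum_{j=i}^{i+k_1+k_2}\psi(\ell,j)\le n$.
   Context: Standing setting: $k_1>k_2\ge 0$ and $n$ are integers, and $k_1+k_2+1$ is composite. $G$ is a finite abelian group written multiplicatively with identity $e$, of order $1+n(k_1+k_2)+\binom{n}{2}(k_1+k_2)^2$, and $T=\{t_1,\dots,t_n\}\subset G$ has $|T|=n$. Notation: for integers $a<b$, $[a,b]^{*}=\{i\ne 0: a\le i\le b\}$; $I=[-k_2,k_1]^{*}$; for an integer $i$, $T^{(i)}=\{t^i:t\in T\}$ (so $T^{(0)}=\{e\}$); for integers $i,j$, $S(i,j)=\{g^ih^j: g,h\in T,\ g\ne h\}$. It is assumed that $G$ is the disjoint union $\{e\}\cup\bigcup_{i\in I}T^{(i)}\cup\bigcup_{i,j\in I,\,i\le j}S(i,j)$; equivalently, in $\mathbb{Z}[G]$, $\sum_{g\in G}g=e+\sum_{i=1}^n\sum_{j\in I}t_i^j+\sum_{1\le i<j\le n}(\sum_{k\in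 I}t_i^k)(\sum_{l\in I}t_j^l)$. Counting function: for integers $m,i$, $\psi(m,i)=|\{t\in T: t^m\in T^{(i)}\}|$. -}

module Defs where

open import Level using (Level; _⊔_)
open import Data.Nat as ℕ using (ℕ; zero; suc; _*_; _^_)
open import Data.Nat.Combinatorics using (_C_)
open import Data.Nat.Primality using (Composite)
open import Data.Integer as ℤ using (ℤ; +_; -[1+_])
open import Data.Fin using (Fin; _<?_)
open import Data.Fin.Properties using (any?)
open import Data.List using (List; []; _∷_; _++_; map; length; filter; upTo; allFin;
  concatMap; cartesianProduct; cartesianProductWith; deduplicate)
open import Data.Product using (_,_; proj₁; proj₂; _×_)
open import Relation.Unary using (Pred)
open import Relation.Binary using (Rel)
import Relation.Binary as B
import Relation.Unary as U
open import Relation.Binary.PropositionalEquality using (_≡_)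
open import Algebra.Bundles using (AbelianGroup)

countL : ∀ {a p} {A : Set a} {P : Pred A p} → U.Decidable P → List A → ℕ
countL P? xs = length (filter P? xs)

-- the list [-k₂, k₁]* = {-k₂,…,-1, 1,…,k₁}
Ilist : ℕ → ℕ → List ℤ
Ilist k₁ k₂ = map (λ m → -[1+ m ]) (upTo k₂) ++ map (λ m → + suc m) (upTo k₁)

module _ {c ℓ : Level} (G : AbelianGroup c ℓ) where
  open AbelianGroup G

  powℕ : Carrier → ℕ → Carrier
  powℕ g zero    = ε
  powℕ g (suc m) = g ∙ powℕ g m

  pow : Carrier → ℤ → Carrier
  pow g (+ m)     = powℕ g m
  pow g -[1+ m ]  = (powℕ g (suc m)) ⁻¹

  module _ (_≟_ : B.Decidable _≈_) {n : ℕ} (t : Fin n → Carrier) where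

    cardTpow : ℤ → ℕ
    cardTpow i = length (deduplicate _≟_ (map (λ a → pow (t a) i) (allFin n)))

    ψ : ℤ → ℤ → ℕ
    ψ m i = countL (λ a → any? (λ b → pow (t a) m ≟ pow (t b) i)) (allFin n)

    -- the formal terms of  e + Σᵢ Σ_{j∈I} tᵢ^j + Σ_{i<j} (Σ_{k∈I} tᵢ^k)(Σ_{l∈I} tⱼ^l)
    termsList : ℕ → ℕ → List Carrier
    termsList k₁ k₂ =
      ε ∷ (concatMap (λ a → map (pow (t a)) (Ilist k₁ k₂)) (allFin n)
        ++ concatMap (λ p → cartesianProductWith _∙_
                               (map (pow (t (proj₁ p))) (Ilist k₁ k₂))
                               (map (pow (t (proj₂ p))) (Ilist k₁ k₂)))
             (filter (λ p → proj₁ p <? proj₂ p) (cartesianProduct (allFin n) (allFin n))))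

record StandingSetting (c ℓ : Level) : Set (Level.suc (c ⊔ ℓ)) where
  field
    k₁ k₂ n : ℕ
    k₂<k₁ : k₂ ℕ.< k₁
    composite : Composite (k₁ ℕ.+ k₂ ℕ.+ 1)
    G : AbelianGroup c ℓ
  open AbelianGroup G
  field
    _≟_ : B.Decidable _≈_
    -- G is finite: an enumeration listing every element exactly once (up to ≈)
    elems : List Carrier
    elems-exact : ∀ g → countL (_≟ g) elems ≡ 1
    order : length elems ≡ 1 ℕ.+ n * (k₁ ℕ.+ k₂) ℕ.+ (n C 2) * (k₁ ℕ.+ k₂) ^ 2
    t : Fin n → Carrier
    t-injective : ∀ a b → t a ≈ t b → a ≡ b
    -- the group-ring identity: every g ∈ G occurs exactly once among the formal terms
    partition : ∀ g → countL (_≟ g) (termsList G _≟_ t k₁ k₂) ≡ 1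

{-# OPTIONS --safe #-}
-- Every element of G is counted exactly once in the expansion of
-- e + Σ_a Σ_{j∈I} t_a^j + Σ_{a<b} (Σ_{k∈I} t_a^k)(Σ_{l∈I} t_b^l), so two terms of the expansion with
-- different exponent vectors have different values: t_a^u = t_a^v forces u = v, and for a ≠ b,
-- t_a^u t_b^v = t_a^u′ t_b^v′ forces (u, v) = (u′, v′), whenever all exponents lie in [-k₂, k₁].
-- Every x ∈ [-k₁-k₂, k₁+k₂] can be written as (v + x) - v with v and v + x in [-k₂, k₁], so
-- t_a^x = e forces x = 0, and t_a^x = t_b^y with a ≠ b forces x = y = 0. This gives (a) and (b);
-- (c) follows because exponents in a window of length k₁+k₂ differ by at most k₁+k₂, and (d)
-- because, by (c), each t^ℓ lies in at most one of T^(i), …, T^(i+k₁+k₂).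
module Submission where

open import Defs
open import Level using (Level)
open import Data.Nat as ℕ using (ℕ; zero; suc; _∸_; z≤n; s≤s)
import Data.Nat.Properties as ℕ
open import Data.Integer as ℤ using (ℤ; +_; -[1+_]; -_; _+_; _-_; _≤_; _<_; +≤+)
import Data.Integer.Properties as ℤ
open import Data.Integer.Tactic.RingSolver using (solve-∀)
open import Data.List using (List; []; _∷_; _++_; [_]; map; length; filter; deduplicate;
  concatMap; cartesianProduct; cartesianProductWith; allFin; upTo)
open import Data.List.Properties using (length-++; length-map; length-tabulate; filter-++; filter-accept;
  filter-all; filter-none; map-++; map-∘; map-cong; map-concatMap; concatMap-cong)
open import Data.Nat.ListAction using (sum)
open import Data.List.Membership.Propositional using (_∈_; lose)
open import Data.List.Membership.Propositional.Properties using (∈-length; ∈-filter⁺; ∈-map⁺;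
  ∈-++⁺ˡ; ∈-++⁺ʳ; ∈-concatMap⁺; ∈-allFin; ∈-upTo⁺; ∈-cartesianProduct⁺; ∈-cartesianProductWith⁺)
open import Data.List.Relation.Unary.Any using (here; there)
open import Data.List.Relation.Unary.All as All using (All; []; _∷_)
import Data.List.Relation.Unary.All.Properties as All
open import Data.List.Relation.Unary.AllPairs as AllPairs using (AllPairs; []; _∷_)
import Data.List.Relation.Unary.AllPairs.Properties as AllPairs
open import Data.List.Relation.Unary.Unique.Propositional.Properties using (allFin⁺)
open import Data.Product using (_×_; _,_; proj₁; proj₂; ∃-syntax)
open import Data.Fin as Fin using (Fin)
import Data.Fin.Properties as Fin
open import Data.Fin.Properties using (any?)
open import Data.Empty using (⊥; ⊥-elim)
open import Function using (_∘_; id)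
open import Relation.Nullary using (¬_; yes; no; ¬?)
open import Relation.Unary using (Pred; Decidable)
open import Relation.Binary using (Rel; tri<; tri≈; tri>) renaming (Decidable to Decidable₂)
open import Relation.Binary.PropositionalEquality
  using (_≡_; _≢_; refl; sym; trans; cong; cong₂; subst; module ≡-Reasoning)
import Algebra.Properties.CommutativeSemigroup as CommutativeSemigroupProperties
open import Algebra.Properties.AbelianGroup ℤ.+-0-abelianGroup using ()
  renaming (identityʳ-unique to i+j≡i⇒j≡0)
import Relation.Binary.Reasoning.Setoid as SetoidReasoning
open CommutativeSemigroupProperties ℕ.+-commutativeSemigroup using (interchange)
open CommutativeSemigroupProperties ℤ.+-commutativeSemigroup using ()
  renaming (x∙yz≈y∙xz to i+[j+k]≡j+[i+k])
open import Algebra.Bundles using (AbelianGroup)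

module _ {a p} {A : Set a} {P : Pred A p} (P? : Decidable P) where

  countL-++ : ∀ xs ys → countL P? (xs ++ ys) ≡ countL P? xs ℕ.+ countL P? ys
  countL-++ xs ys = trans (cong length (filter-++ P? xs ys)) (length-++ (filter P? xs))

  countL-∷-mono : ∀ x xs → countL P? xs ℕ.≤ countL P? (x ∷ xs)
  countL-∷-mono x xs = ℕ.≤-trans (ℕ.m≤n+m (countL P? xs) (countL P? [ x ]))
                                  (ℕ.≤-reflexive (sym (countL-++ [ x ] xs)))

  module _ {b} {B : Set b} (f : B → A) where

    1≤countL-map : ∀ {x xs} → x ∈ xs → P (f x) → 1 ℕ.≤ countL P? (map f xs)
    1≤countL-map x∈xs px = ∈-length (∈-filter⁺ P? (∈-map⁺ f x∈xs) px)

    2≤countL-map : ∀ {x y xs} → x ∈ xs → y ∈ xs → x ≢ y → P (f x) → P (f y) →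
                   2 ℕ.≤ countL P? (map f xs)
    2≤countL-map (here refl) (here refl) x≢y _ _ = ⊥-elim (x≢y refl)
    2≤countL-map {xs = z ∷ zs} (here refl) (there y∈zs) _ px py
      rewrite filter-accept P? {xs = map f zs} px = s≤s (1≤countL-map y∈zs py)
    2≤countL-map {xs = z ∷ zs} (there x∈zs) (here refl) _ px py
      rewrite filter-accept P? {xs = map f zs} py = s≤s (1≤countL-map x∈zs px)
    2≤countL-map {xs = z ∷ zs} (there x∈zs) (there y∈zs) x≢y px py =
      ℕ.≤-trans (2≤countL-map x∈zs y∈zs x≢y px py) (countL-∷-mono (f z) (map f zs))

sum-map-+ : ∀ {a} {A : Set a} (f g : A → ℕ) xs →
            sum (map (λ x → f x ℕ.+ g x) xs) ≡ sum (map f xs) ℕ.+ sum (map g xs)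
sum-map-+ f g [] = refl
sum-map-+ f g (x ∷ xs) = trans (cong (f x ℕ.+ g x ℕ.+_) (sum-map-+ f g xs)) (interchange (f x) (g x) _ _)

module _ {a b p} {A : Set a} {B : Set b} {P : A → Pred B p} (P? : ∀ x → Decidable (P x)) where

  private
    Disjoint : Rel A _
    Disjoint x y = ∀ {z} → P x z → P y z → ⊥

  sum-countL-singleton≤1 : ∀ z {xs} → AllPairs Disjoint xs →
                           sum (map (λ x → countL (P? x) [ z ]) xs) ℕ.≤ 1
  sum-countL-singleton≤1 z [] = z≤n
  sum-countL-singleton≤1 z {x ∷ xs} (x⊥xs ∷ disjoint) with P? x z
  ... | no _    = sum-countL-singleton≤1 z disjoint
  ... | yes pxz = ℕ.≤-reflexive (cong suc (sum-zero x⊥xs))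
    where
    sum-zero : ∀ {ys} → All (Disjoint x) ys → sum (map (λ y → countL (P? y) [ z ]) ys) ≡ 0
    sum-zero [] = refl
    sum-zero {y ∷ ys} (x⊥y ∷ x⊥ys) with P? y z
    ... | yes pyz = ⊥-elim (x⊥y pxz pyz)
    ... | no _    = sum-zero x⊥ys

  sum-countL≤length : ∀ {xs} → AllPairs Disjoint xs → ∀ zs →
                      sum (map (λ x → countL (P? x) zs) xs) ℕ.≤ length zs
  sum-countL≤length {xs} _ [] = ℕ.≤-reflexive (sum-zeros xs)
    where
    sum-zeros : ∀ ys → sum (map (λ _ → 0) ys) ≡ 0
    sum-zeros [] = refl
    sum-zeros (_ ∷ ys) = sum-zeros ys
  sum-countL≤length {xs} disjoint (z ∷ zs) = begin
    sum (map (λ x → countL (P? x) (z ∷ zs)) xs)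
      ≡⟨ cong sum (map-cong (λ x → countL-++ (P? x) [ z ] zs) xs) ⟩
    sum (map (λ x → countL (P? x) [ z ] ℕ.+ countL (P? x) zs) xs)
      ≡⟨ sum-map-+ (λ x → countL (P? x) [ z ]) (λ x → countL (P? x) zs) xs ⟩
    sum (map (λ x → countL (P? x) [ z ]) xs) ℕ.+ sum (map (λ x → countL (P? x) zs) xs)
      ≤⟨ ℕ.+-mono-≤ (sum-countL-singleton≤1 z disjoint) (sum-countL≤length disjoint zs) ⟩
    suc (length zs) ∎
    where open ℕ.≤-Reasoning

module _ {a r} {A : Set a} {R : Rel A r} (R? : Decidable₂ R) where

  deduplicate-distinct : ∀ {xs} → AllPairs (λ x y → ¬ R x y) xs → deduplicate R? xs ≡ xs
  deduplicate-distinct [] = refl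
  deduplicate-distinct (x≁xs ∷ distinct) =
    cong (_ ∷_) (trans (filter-all (¬? ∘ R? _) (All.deduplicate⁺ R? x≁xs)) (deduplicate-distinct distinct))

map-cartesianProductWith : ∀ {a a′ b b′ c d} {A : Set a} {A′ : Set a′} {B : Set b} {B′ : Set b′}
  {C : Set c} {D : Set d} {f : A → B → C} {g : A′ → B′ → D} (h : C → D) (u : A → A′) (v : B → B′) →
  (∀ x y → h (f x y) ≡ g (u x) (v y)) →
  ∀ xs ys → map h (cartesianProductWith f xs ys) ≡ cartesianProductWith g (map u xs) (map v ys)
map-cartesianProductWith h u v natural [] ys = refl
map-cartesianProductWith {f = f} {g} h u v natural (x ∷ xs) ys = begin
  map h (map (f x) ys ++ cartesianProductWith f xs ys)
    ≡⟨ map-++ h (map (f x) ys) _ ⟩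
  map h (map (f x) ys) ++ map h (cartesianProductWith f xs ys)
    ≡⟨ cong₂ _++_ (sym (map-∘ ys)) (map-cartesianProductWith h u v natural xs ys) ⟩
  map (h ∘ f x) ys ++ cartesianProductWith g (map u xs) (map v ys)
    ≡⟨ cong (_++ _) (trans (map-cong (natural x) ys) (map-∘ ys)) ⟩
  map (g (u x)) (map v ys) ++ cartesianProductWith g (map u xs) (map v ys) ∎
  where open ≡-Reasoning

module _ {c ℓ} (G : AbelianGroup c ℓ) where
  open AbelianGroup G renaming (refl to ≈-refl; sym to ≈-sym)
  open import Algebra.Properties.AbelianGroup G using (⁻¹-∙-comm)
  open CommutativeSemigroupProperties commutativeSemigroup using (x∙yz≈y∙xz)
  open SetoidReasoning setoid

  pow-suc : ∀ g i → pow G g (ℤ.suc i) ≈ g ∙ pow G g i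
  pow-suc g (+ m) = ≈-refl
  pow-suc g -[1+ zero ] = ≈-sym (begin
    g ∙ (g ∙ ε) ⁻¹       ≈⟨ ∙-congʳ (identityʳ g) ⟨
    (g ∙ ε) ∙ (g ∙ ε) ⁻¹ ≈⟨ inverseʳ (g ∙ ε) ⟩
    ε                    ∎)
  pow-suc g -[1+ suc m ] = ≈-sym (begin
    g ∙ (g ∙ h) ⁻¹       ≈⟨ ∙-congˡ (⁻¹-∙-comm g h) ⟨
    g ∙ (g ⁻¹ ∙ h ⁻¹)    ≈⟨ assoc g (g ⁻¹) (h ⁻¹) ⟨
    (g ∙ g ⁻¹) ∙ h ⁻¹    ≈⟨ ∙-congʳ (inverseʳ g) ⟩
    ε ∙ h ⁻¹             ≈⟨ identityˡ (h ⁻¹) ⟩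
    h ⁻¹                 ∎)
    where h = g ∙ powℕ G g m

  pow-pred : ∀ g i → pow G g (ℤ.pred i) ≈ g ⁻¹ ∙ pow G g i
  pow-pred g i = begin
    pow G g (ℤ.pred i)                 ≈⟨ identityˡ _ ⟨
    ε ∙ pow G g (ℤ.pred i)             ≈⟨ ∙-congʳ (inverseˡ g) ⟨
    (g ⁻¹ ∙ g) ∙ pow G g (ℤ.pred i)    ≈⟨ assoc (g ⁻¹) g _ ⟩
    g ⁻¹ ∙ (g ∙ pow G g (ℤ.pred i))    ≈⟨ ∙-congˡ (pow-suc g (ℤ.pred i)) ⟨
    g ⁻¹ ∙ pow G g (ℤ.suc (ℤ.pred i))  ≡⟨ cong (λ j → g ⁻¹ ∙ pow G g j) (ℤ.suc-pred i) ⟩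
    g ⁻¹ ∙ pow G g i                   ∎

  pow-+ : ∀ g i j → pow G g (i + j) ≈ pow G g i ∙ pow G g j
  pow-+ g i (+ zero) = begin
    pow G g (i + + 0)  ≡⟨ cong (pow G g) (ℤ.+-identityʳ i) ⟩
    pow G g i          ≈⟨ identityʳ _ ⟨
    pow G g i ∙ ε      ∎
  pow-+ g i (+ suc m) = begin
    pow G g (i + + suc m)          ≡⟨ cong (pow G g) (i+[j+k]≡j+[i+k] i (+ 1) (+ m)) ⟩
    pow G g (ℤ.suc (i + + m))      ≈⟨ pow-suc g (i + + m) ⟩
    g ∙ pow G g (i + + m)          ≈⟨ ∙-congˡ (pow-+ g i (+ m)) ⟩
    g ∙ (pow G g i ∙ pow G g (+ m)) ≈⟨ x∙yz≈y∙xz g _ _ ⟩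
    pow G g i ∙ (g ∙ pow G g (+ m)) ∎
  pow-+ g i -[1+ zero ] = begin
    pow G g (i + -[1+ 0 ])    ≡⟨ cong (pow G g) (ℤ.+-comm i -[1+ 0 ]) ⟩
    pow G g (ℤ.pred i)        ≈⟨ pow-pred g i ⟩
    g ⁻¹ ∙ pow G g i          ≈⟨ comm (g ⁻¹) _ ⟩
    pow G g i ∙ g ⁻¹          ≈⟨ ∙-congˡ (⁻¹-cong (identityʳ g)) ⟨
    pow G g i ∙ (g ∙ ε) ⁻¹    ∎
  pow-+ g i -[1+ suc m ] = begin
    pow G g (i + -[1+ suc m ])         ≡⟨ cong (pow G g) (ℤ.+-pred i -[1+ m ]) ⟩
    pow G g (ℤ.pred (i + -[1+ m ]))    ≈⟨ pow-pred g (i + -[1+ m ]) ⟩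
    g ⁻¹ ∙ pow G g (i + -[1+ m ])      ≈⟨ ∙-congˡ (pow-+ g i -[1+ m ]) ⟩
    g ⁻¹ ∙ (pow G g i ∙ h ⁻¹)          ≈⟨ x∙yz≈y∙xz (g ⁻¹) _ _ ⟩
    pow G g i ∙ (g ⁻¹ ∙ h ⁻¹)          ≈⟨ ∙-congˡ (⁻¹-∙-comm g h) ⟩
    pow G g i ∙ (g ∙ h) ⁻¹             ∎
    where h = g ∙ powℕ G g m

module StandingSettingProperties {c ℓ} (S : StandingSetting c ℓ) where
  open StandingSetting S
  open AbelianGroup G
    using (Carrier; _≈_; _∙_; ε; setoid; ∙-congˡ; ∙-congʳ; identityˡ; identityʳ; comm; commutativeSemigroup)
    renaming (refl to ≈-refl; sym to ≈-sym; trans to ≈-trans)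
  open import Algebra.Properties.AbelianGroup G using (identityʳ-unique)
  open CommutativeSemigroupProperties commutativeSemigroup using (xy∙z≈x∙zy)

  K : ℕ
  K = k₁ ℕ.+ k₂

  infix 8 _^_
  _^_ : Carrier → ℤ → Carrier
  _^_ = pow G

  InRange : ℤ → Set
  InRange u = - + k₂ ≤ u × u ≤ + k₁

  InWindow : ℤ → Set
  InWindow x = - + K ≤ x × x ≤ + K

  Exponents : Set
  Exponents = Fin n → ℤ

  infix 9 _↦_
  _↦_ : Fin n → ℤ → Exponents
  (a ↦ j) b with b Fin.≟ a
  ... | yes _ = j
  ... | no _  = + 0

  ↦-at : ∀ a j → (a ↦ j) a ≡ j
  ↦-at a j with a Fin.≟ a
  ... | yes _   = refl
  ... | no a≢a  = ⊥-elim (a≢a refl)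

  ↦-away : ∀ {a b} j → b ≢ a → (a ↦ j) b ≡ + 0
  ↦-away {a} {b} j b≢a with b Fin.≟ a
  ... | yes b≡a = ⊥-elim (b≢a b≡a)
  ... | no _    = refl

  -- The terms of termsList, each labelled by its exponent vector, so that distinct terms can be
  -- told apart even when their values coincide.
  Monomial : Set c
  Monomial = Exponents × Carrier

  one : Monomial
  one = (λ _ → + 0) , ε

  power : Fin n → ℤ → Monomial
  power a j = a ↦ j , t a ^ j

  product : Fin n → Fin n → ℤ → ℤ → Monomial
  product a b k l = (λ d → (a ↦ k) d + (b ↦ l) d) , t a ^ k ∙ t b ^ l

  I : List ℤ
  I = Ilist k₁ k₂

  orderedPairs : List (Fin n × Fin n)
  orderedPairs = filter (λ p → proj₁ p Fin.<? proj₂ p) (cartesianProduct (allFin n) (allFin n))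

  expansion : List Monomial
  expansion = one ∷ (concatMap (λ a → map (power a) I) (allFin n)
                 ++ concatMap (λ p → cartesianProductWith (product (proj₁ p) (proj₂ p)) I I) orderedPairs)

  map-proj₂-expansion : map proj₂ expansion ≡ termsList G _≟_ t k₁ k₂
  map-proj₂-expansion = cong (ε ∷_) (begin
    map proj₂ (powers ++ products)
      ≡⟨ map-++ proj₂ powers products ⟩
    map proj₂ powers ++ map proj₂ products
      ≡⟨ cong₂ _++_
           (trans (map-concatMap proj₂ _ (allFin n)) (concatMap-cong (λ a → sym (map-∘ I)) (allFin n)))
           (trans (map-concatMap proj₂ _ orderedPairs)
                  (concatMap-cong (λ p → map-cartesianProductWith proj₂ (t (proj₁ p) ^_) (t (proj₂ p) ^_)
                                           (λ _ _ → refl) I I)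
                                  orderedPairs)) ⟩
    _ ∎)
    where
    open ≡-Reasoning
    powers = concatMap (λ a → map (power a) I) (allFin n)
    products = concatMap (λ p → cartesianProductWith (product (proj₁ p) (proj₂ p)) I I) orderedPairs

  exponents-determined : ∀ {x y} → x ∈ expansion → y ∈ expansion → proj₂ x ≈ proj₂ y →
                         ∀ d → proj₁ x d ≡ proj₁ y d
  exponents-determined {x} {y} x∈ y∈ x≈y d with proj₁ x d ℤ.≟ proj₁ y d
  ... | yes same = same
  ... | no differ = ⊥-elim (ℕ.<-irrefl refl (begin
    2                                              ≤⟨ 2≤countL-map (_≟ proj₂ y) proj₂ x∈ y∈ x≢y x≈y ≈-refl ⟩
    countL (_≟ proj₂ y) (map proj₂ expansion)      ≡⟨ cong (countL (_≟ proj₂ y)) map-proj₂-expansion ⟩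
    countL (_≟ proj₂ y) (termsList G _≟_ t k₁ k₂)  ≡⟨ partition (proj₂ y) ⟩
    1                                              ∎))
    where
    open ℕ.≤-Reasoning
    x≢y : x ≢ y
    x≢y refl = differ refl

  ∈-I : ∀ {u} → InRange u → u ≢ + 0 → u ∈ I
  ∈-I {+ zero}    _              u≢0 = ⊥-elim (u≢0 refl)
  ∈-I {+ suc m}   (_ , +≤+ m<k₁) _   = ∈-++⁺ʳ _ (∈-map⁺ _ (∈-upTo⁺ m<k₁))
  ∈-I { -[1+ m ]} (-k₂≤u , _)    _   =
    ∈-++⁺ˡ (∈-map⁺ _ (∈-upTo⁺ (ℤ.drop‿+≤+ (ℤ.neg-cancel-≤ {+ k₂} {+ suc m} -k₂≤u))))

  power-∈ : ∀ a {j} → j ∈ I → power a j ∈ expansion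
  power-∈ a j∈I = there (∈-++⁺ˡ (∈-concatMap⁺ _ (lose (∈-allFin a) (∈-map⁺ (power a) j∈I))))

  product-∈ : ∀ {a b k l} → a Fin.< b → k ∈ I → l ∈ I → product a b k l ∈ expansion
  product-∈ {a} {b} a<b k∈I l∈I = there (∈-++⁺ʳ _ (∈-concatMap⁺ _ (lose
    (∈-filter⁺ (λ p → proj₁ p Fin.<? proj₂ p) (∈-cartesianProduct⁺ (∈-allFin a) (∈-allFin b)) a<b)
    (∈-cartesianProductWith⁺ (product a b) k∈I l∈I))))

  power-occurs : ∀ a {u} → InRange u →
                 ∃[ x ] x ∈ expansion × proj₁ x a ≡ u × proj₂ x ≈ t a ^ u
  power-occurs a {u} u∈ with u ℤ.≟ + 0
  ... | yes refl = one , here refl , refl , ≈-refl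
  ... | no u≢0   = power a u , power-∈ a (∈-I u∈ u≢0) , ↦-at a u , ≈-refl

  product-occurs : ∀ {a b} → a ≢ b → ∀ {u v} → InRange u → InRange v →
                   ∃[ x ] x ∈ expansion × proj₁ x a ≡ u × proj₁ x b ≡ v × proj₂ x ≈ t a ^ u ∙ t b ^ v
  product-occurs {a} {b} a≢b {u} {v} u∈ v∈ with u ℤ.≟ + 0 | v ℤ.≟ + 0
  ... | yes refl | yes refl = one , here refl , refl , refl , ≈-sym (identityˡ ε)
  ... | no u≢0   | yes refl =
    power a u , power-∈ a (∈-I u∈ u≢0) , ↦-at a u , ↦-away u (a≢b ∘ sym) , ≈-sym (identityʳ _)
  ... | yes refl | no v≢0   =
    power b v , power-∈ b (∈-I v∈ v≢0) , ↦-away v a≢b , ↦-at b v , ≈-sym (identityˡ _)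
  ... | no u≢0   | no v≢0   with Fin.<-cmp a b
  ...   | tri< a<b _ _ = product a b u v , product-∈ a<b (∈-I u∈ u≢0) (∈-I v∈ v≢0) ,
    trans (cong₂ _+_ (↦-at a u) (↦-away v a≢b)) (ℤ.+-identityʳ u) ,
    trans (cong₂ _+_ (↦-away u (a≢b ∘ sym)) (↦-at b v)) (ℤ.+-identityˡ v) , ≈-refl
  ...   | tri≈ _ a≡b _ = ⊥-elim (a≢b a≡b)
  ...   | tri> _ _ b<a = product b a v u , product-∈ b<a (∈-I v∈ v≢0) (∈-I u∈ u≢0) ,
    trans (cong₂ _+_ (↦-away v a≢b) (↦-at a u)) (ℤ.+-identityˡ u) ,
    trans (cong₂ _+_ (↦-at b v) (↦-away u (a≢b ∘ sym))) (ℤ.+-identityʳ v) , comm _ _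

  pow-injective-on-range : ∀ a {u v} → InRange u → InRange v → t a ^ u ≈ t a ^ v → u ≡ v
  pow-injective-on-range a {u} {v} u∈ v∈ eq =
    let x , x∈ , xa≡u , x≈ = power-occurs a u∈
        y , y∈ , ya≡v , y≈ = power-occurs a v∈
    in begin
      u          ≡⟨ xa≡u ⟨
      proj₁ x a  ≡⟨ exponents-determined x∈ y∈ (≈-trans x≈ (≈-trans eq (≈-sym y≈))) a ⟩
      proj₁ y a  ≡⟨ ya≡v ⟩
      v          ∎
    where open ≡-Reasoning

  product-injective-on-range : ∀ {a b} → a ≢ b → ∀ {u v u′ v′} →
    InRange u → InRange v → InRange u′ → InRange v′ →
    t a ^ u ∙ t b ^ v ≈ t a ^ u′ ∙ t b ^ v′ → u ≡ u′ × v ≡ v′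
  product-injective-on-range {a} {b} a≢b u∈ v∈ u′∈ v′∈ eq =
    let x , x∈ , xa≡u , xb≡v , x≈ = product-occurs a≢b u∈ v∈
        y , y∈ , ya≡u′ , yb≡v′ , y≈ = product-occurs a≢b u′∈ v′∈
        same = exponents-determined x∈ y∈ (≈-trans x≈ (≈-trans eq (≈-sym y≈)))
    in trans (sym xa≡u) (trans (same a) ya≡u′) , trans (sym xb≡v) (trans (same b) yb≡v′)

  -k₂∈range : InRange (- + k₂)
  -k₂∈range = ℤ.≤-refl , ℤ.neg-≤-pos

  -k₂+m∈range : ∀ {m} → m ℕ.≤ K → InRange (- + k₂ + + m)
  -k₂+m∈range {m} m≤K =
    ℤ.i≤i+j (- + k₂) (+ m) ,
    ℤ.≤-trans (ℤ.+-monoʳ-≤ (- + k₂) (+≤+ m≤K)) (ℤ.≤-reflexive (-b+[a+b]≡a (+ k₁) (+ k₂)))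
    where
    -b+[a+b]≡a : ∀ a b → - b + (a + b) ≡ a
    -b+[a+b]≡a = solve-∀

  window-as-range-difference : ∀ {x} → InWindow x → ∃[ v ] InRange v × InRange (v + x)
  window-as-range-difference {+ m} (_ , +≤+ m≤K) = - + k₂ , -k₂∈range , -k₂+m∈range m≤K
  window-as-range-difference { -[1+ m ]} (-K≤x , _) =
    - + k₂ + + suc m , -k₂+m∈range 1+m≤K ,
    subst InRange (sym ([a+b]-b≡a (- + k₂) (+ suc m))) -k₂∈range
    where
    1+m≤K : suc m ℕ.≤ K
    1+m≤K = ℤ.drop‿+≤+ (ℤ.neg-cancel-≤ {+ K} {+ suc m} -K≤x)
    [a+b]-b≡a : ∀ a b → (a + b) - b ≡ a
    [a+b]-b≡a = solve-∀

  -K≤-k₂ : - + K ≤ - + k₂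
  -K≤-k₂ = ℤ.neg-mono-≤ (+≤+ (ℕ.m≤n+m k₂ k₁))

  range⊆window : ∀ {u} → InRange u → InWindow u
  range⊆window (-k₂≤u , u≤k₁) = ℤ.≤-trans -K≤-k₂ -k₂≤u , ℤ.≤-trans u≤k₁ (+≤+ (ℕ.m≤m+n k₁ k₂))

  pow≈ε⇒≡0 : ∀ a {x} → InWindow x → t a ^ x ≈ ε → x ≡ + 0
  pow≈ε⇒≡0 a {x} x∈ tᵃˣ≈ε =
    let v , v∈ , v+x∈ = window-as-range-difference x∈
    in i+j≡i⇒j≡0 v x (pow-injective-on-range a v+x∈ v∈ (begin
      t a ^ (v + x)      ≈⟨ pow-+ G (t a) v x ⟩
      t a ^ v ∙ t a ^ x  ≈⟨ ∙-congˡ tᵃˣ≈ε ⟩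
      t a ^ v ∙ ε        ≈⟨ identityʳ _ ⟩
      t a ^ v            ∎))
    where open SetoidReasoning setoid

  pow≈pow⇒≡0 : ∀ {a b} → a ≢ b → ∀ {x y} → InWindow x → InWindow y → t a ^ x ≈ t b ^ y →
               x ≡ + 0 × y ≡ + 0
  pow≈pow⇒≡0 {a} {b} a≢b {x} {y} x∈ y∈ eq =
    let v , v∈ , v+x∈ = window-as-range-difference x∈
        w , w∈ , w+y∈ = window-as-range-difference y∈
        v+x≡v , w≡w+y = product-injective-on-range a≢b v+x∈ w∈ v∈ w+y∈ (begin
          t a ^ (v + x) ∙ t b ^ w        ≈⟨ ∙-congʳ (pow-+ G (t a) v x) ⟩
          (t a ^ v ∙ t a ^ x) ∙ t b ^ w  ≈⟨ ∙-congʳ (∙-congˡ eq) ⟩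
          (t a ^ v ∙ t b ^ y) ∙ t b ^ w  ≈⟨ xy∙z≈x∙zy _ _ _ ⟩
          t a ^ v ∙ (t b ^ w ∙ t b ^ y)  ≈⟨ ∙-congˡ (pow-+ G (t b) w y) ⟨
          t a ^ v ∙ t b ^ (w + y)        ∎)
    in i+j≡i⇒j≡0 v x v+x≡v , i+j≡i⇒j≡0 w y (sym w≡w+y)
    where open SetoidReasoning setoid

  pow≉pow-in-window : ∀ a b {x y} → InWindow x → InWindow y → + 0 < y - x → y - x ≤ + K →
                      ¬ (t a ^ x ≈ t b ^ y)
  pow≉pow-in-window a b {x} {y} x∈ y∈ 0<y-x y-x≤K eq with a Fin.≟ b
  ... | no a≢b =
    let x≡0 , y≡0 = pow≈pow⇒≡0 a≢b x∈ y∈ eq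
    in ℤ.<-irrefl (sym (cong₂ _-_ y≡0 x≡0)) 0<y-x
  ... | yes refl =
    ℤ.<-irrefl (sym (pow≈ε⇒≡0 a (ℤ.≤-trans ℤ.neg-≤-pos (ℤ.<⇒≤ 0<y-x) , y-x≤K) tᵃ⁽ʸ⁻ˣ⁾≈ε)) 0<y-x
    where
    open SetoidReasoning setoid
    x+[y-x]≡y : ∀ x y → x + (y - x) ≡ y
    x+[y-x]≡y = solve-∀
    tᵃ⁽ʸ⁻ˣ⁾≈ε : t a ^ (y - x) ≈ ε
    tᵃ⁽ʸ⁻ˣ⁾≈ε = identityʳ-unique (t a ^ x) (t a ^ (y - x)) (begin
      t a ^ x ∙ t a ^ (y - x)  ≈⟨ pow-+ G (t a) x (y - x) ⟨
      t a ^ (x + (y - x))      ≡⟨ cong (t a ^_) (x+[y-x]≡y x y) ⟩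
      t a ^ y                  ≈⟨ eq ⟨
      t a ^ x                  ∎)

  cardTpow≡n : ∀ {i} → i ≢ + 0 → InWindow i → cardTpow G _≟_ t i ≡ n
  cardTpow≡n {i} i≢0 i∈ = begin
    length (deduplicate _≟_ (map (λ a → t a ^ i) (allFin n)))
      ≡⟨ cong length (deduplicate-distinct _≟_ distinct) ⟩
    length (map (λ a → t a ^ i) (allFin n))
      ≡⟨ length-map _ (allFin n) ⟩
    length (allFin n)
      ≡⟨ length-tabulate id ⟩
    n ∎
    where
    open ≡-Reasoning
    distinct : AllPairs (λ g h → ¬ g ≈ h) (map (λ a → t a ^ i) (allFin n))
    distinct = AllPairs.map⁺
      (AllPairs.map (λ a≢b eq → i≢0 (proj₁ (pow≈pow⇒≡0 a≢b i∈ i∈ eq))) (allFin⁺ n))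

  pow≈pow⇒generators≈ : ∀ {i j} → - + k₂ ≤ i → i ≤ + K → j ≢ + 0 → InRange j →
                        ∀ a b → t a ^ i ≈ t b ^ j → t a ≈ t b
  pow≈pow⇒generators≈ -k₂≤i i≤K j≢0 j∈ a b eq with a Fin.≟ b
  ... | yes refl = ≈-refl
  ... | no a≢b   =
    ⊥-elim (j≢0 (proj₂ (pow≈pow⇒≡0 a≢b (ℤ.≤-trans -K≤-k₂ -k₂≤i , i≤K) (range⊆window j∈) eq)))

  pow-window-disjoint : ∀ {i} → - + K ≤ i → i ≤ + 0 → ∀ {p q} → p ℕ.< q → q ℕ.≤ K →
                        ∀ a b → ¬ (t a ^ (i + + p) ≈ t b ^ (i + + q))
  pow-window-disjoint {i} -K≤i i≤0 {p} {q} p<q q≤K a b =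
    pow≉pow-in-window a b (shift-∈-window (ℕ.<⇒≤ (ℕ.<-≤-trans p<q q≤K))) (shift-∈-window q≤K)
      (subst (+ 0 <_) (sym difference) (ℤ.+<+ (ℕ.m<n⇒0<n∸m p<q)))
      (subst (_≤ + K) (sym difference) (+≤+ (ℕ.≤-trans (ℕ.m∸n≤m q p) q≤K)))
    where
    shift-∈-window : ∀ {r} → r ℕ.≤ K → InWindow (i + + r)
    shift-∈-window {r} r≤K =
      ℤ.≤-trans -K≤i (ℤ.i≤i+j i (+ r)) , ℤ.≤-trans (ℤ.+-monoˡ-≤ (+ r) i≤0) (+≤+ r≤K)
    [i+b]-[i+a]≡b-a : ∀ i a b → (i + b) - (i + a) ≡ b - a
    [i+b]-[i+a]≡b-a = solve-∀
    difference : (i + + q) - (i + + p) ≡ + (q ∸ p)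
    difference =
      trans ([i+b]-[i+a]≡b-a i (+ p) (+ q)) (trans (ℤ.[+m]-[+n]≡m⊖n q p) (ℤ.⊖-≥ (ℕ.<⇒≤ p<q)))

  ψ≡0 : ∀ {l i} → - + K ≤ i → l ≤ + K → + 0 < l - i → l - i ≤ + K → ψ G _≟_ t l i ≡ 0
  ψ≡0 {l} {i} -K≤i l≤K 0<l-i l-i≤K =
    cong length (filter-none (λ a → any? (λ b → (t a ^ l) ≟ (t b ^ i))) {allFin n}
                             (All.tabulate λ {a} _ → tᵃˡ∉Tⁱ a))
    where
    i≤l : i ≤ l
    i≤l = ℤ.0≤i-j⇒j≤i (ℤ.<⇒≤ 0<l-i)
    tᵃˡ∉Tⁱ : ∀ a → ¬ (∃[ b ] t a ^ l ≈ t b ^ i)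
    tᵃˡ∉Tⁱ a (b , eq) = pow≉pow-in-window b a (-K≤i , ℤ.≤-trans i≤l l≤K) (ℤ.≤-trans -K≤i i≤l , l≤K)
                          0<l-i l-i≤K (≈-sym eq)

  sum-ψ-window≤n : ∀ l {i} → - + K ≤ i → i ≤ + 0 →
                   sum (map (λ p → ψ G _≟_ t l (i + + p)) (upTo (suc K))) ℕ.≤ n
  sum-ψ-window≤n l {i} -K≤i i≤0 =
    subst (sum (map (λ p → ψ G _≟_ t l (i + + p)) (upTo (suc K))) ℕ.≤_) (length-tabulate id)
    (sum-countL≤length (λ p a → any? (λ b → (t a ^ l) ≟ (t b ^ (i + + p))))
                       (AllPairs.applyUpTo⁺₁ id (suc K) disjoint) (allFin n))
    where
    disjoint : ∀ {p q} → p ℕ.< q → q ℕ.< suc K → ∀ {a} →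
               ∃[ b ] t a ^ l ≈ t b ^ (i + + p) → ∃[ b ] t a ^ l ≈ t b ^ (i + + q) → ⊥
    disjoint p<q q<1+K (b , eq) (b′ , eq′) =
      pow-window-disjoint -K≤i i≤0 p<q (ℕ.≤-pred q<1+K) b b′ (≈-trans (≈-sym eq) eq′)

lemma2p4 : ∀ {c ℓ : Level} (S : StandingSetting c ℓ) →
  let open StandingSetting S
      open AbelianGroup G using (_≈_)
      K = + (k₁ ℕ.+ k₂)
      _^_ = pow G
      card = cardTpow G _≟_ t
      Ψ = ψ G _≟_ t
  in
  -- (a)
  (∀ (i : ℤ) → i ≢ + 0 → - K ≤ i → i ≤ K → card i ≡ n)
  ×
  -- (b)
  (∀ (i j : ℤ) → - (+ k₂) ≤ i → i ≤ K → j ≢ + 0 → - (+ k₂) ≤ j → j ≤ + k₁ →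
     ∀ (a b : Fin n) → (t a ^ i) ≈ (t b ^ j) → t a ≈ t b)
  ×
  -- (c) T^{(i)}, …, T^{(i+k₁+k₂)} pairwise disjoint
  (∀ (i : ℤ) → - K ≤ i → i ≤ + 0 → ∀ (p q : ℕ) → p ℕ.< q → q ℕ.≤ k₁ ℕ.+ k₂ →
     ∀ (a b : Fin n) → ¬ ((t a ^ (i + + p)) ≈ (t b ^ (i + + q))))
  ×
  -- (c) in particular: ψ(l,i) = 0 when 0 < l - i ≤ k₁+k₂ (with l, i in such a window)
  (∀ (l i : ℤ) → - K ≤ i → l ≤ K → + 0 < l - i → l - i ≤ K → Ψ l i ≡ 0)
  ×
  -- (d)
  (∀ (l i : ℤ) → + (ℕ.suc k₁) ≤ l → l ≤ + (2 ℕ.* k₁) → - K ≤ i → i ≤ + 0 →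
     sum (map (λ p → Ψ l (i + + p)) (upTo (ℕ.suc (k₁ ℕ.+ k₂)))) ℕ.≤ n)
lemma2p4 S =
    (λ i i≢0 -K≤i i≤K → cardTpow≡n i≢0 (-K≤i , i≤K))
  , (λ i j -k₂≤i i≤K j≢0 -k₂≤j j≤k₁ → pow≈pow⇒generators≈ -k₂≤i i≤K j≢0 (-k₂≤j , j≤k₁))
  , (λ i -K≤i i≤0 p q p<q q≤K → pow-window-disjoint -K≤i i≤0 p<q q≤K)
  , (λ l i → ψ≡0)
  , (λ l i _ _ → sum-ψ-window≤n l)
  where open StandingSettingProperties S
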